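{- Let $G=(S\cup A,E)$ be a bipartite graph with $E\subseteq S\times A$, integer values $v_i\ge 0$ ($i\in S$) and positive integer exposures $e_j$ ($j\in A$), let $M$ be the maximum of all $v_i$ and $e_j$, and let $n=|S|+|A|$. Let $f$ be the flow produced by the following procedure. Set $S_1=S$, $A_1=A$. In phase $k$ (while both $S_k$ and $A_k$ are nonempty), for $\lambda\in[0,1]$ let $P_\lambda$ be the network with source $s$, sink $t$, edges $(s,i)$ of capacity $v_i$ for $i\in S_k$, edges $(j,t)$ of capacity $\lambda e_j$ for $j\in A_k$, and infinite-capacity edges $(i,j)$ for $ij\in E$ with $i\in S_k,j\in A_k$; $P_\lambda$ is feasible if it has an $s$–$t$ flow saturating every edge $(j,t)$. Let $\lambda_k$ be the maximum feasible $\lambda\in[0,1]$, $f^{(k)}$ a maximum flow in $P_{\lambda_k}$, and $S'_k\subseteq S_k$, $A'_k\subseteq A_k$ the nodes unreachable from $s$ in the residual network of $f^{(k)}$; set $S_{k+1}=S_k\setminus S'_k$, $A_{k+1}=A_k\setminus A'_k$. Put $f_{ij}=f^{(k)}_{ij}$ if $i\in S'_k$, $j\in A'_k$ for some $k$, and $f_{ij}=0$ otherwise. Then for every $j\in A$, the risk ratio $r^f_j=(e_j-\sum_{i:\,ij\in E}f_{ij})/e_j$ is a rational number that can be written as $p/q$ with integers $0\le p\le nM$ and $1\le q\le nM$.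
   Context: The risk ratio of account $j$ under $f$ is $r^f_j=(e_j-\sum_{i:\,ij\in E} f_{ij})/e_j$.
   Formalization: The parameter λ and all flows in the networks $P_\lambda$, including the maximum flows $f^{(k)}$ and so the flow $f$, take rational values. -}

module Defs where

open import Data.Bool using (Bool; true; false; if_then_else_; _∧_; not)
open import Data.Nat as ℕ using (ℕ; zero; suc; _⊔_)
open import Data.Fin using (Fin; zero; suc)
open import Data.Integer using (+_)
open import Data.Rational using (ℚ; 0ℚ; 1ℚ; _+_; _-_; _*_; _≤_; _<_; _/_)
open import Data.Product using (Σ; _×_; ∃)
open import Data.Sum using (_⊎_)
open import Relation.Nullary using (¬_)
open import Relation.Binary.PropositionalEquality using (_≡_)
open import Relation.Binary.Construct.Closure.ReflexiveTransitive using (Star)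

ℕ→ℚ : ℕ → ℚ
ℕ→ℚ n = (+ n) / 1

sumℚ : (n : ℕ) → (Fin n → ℚ) → ℚ
sumℚ zero f = 0ℚ
sumℚ (suc n) f = f zero + sumℚ n (λ i → f (suc i))

maxℕ : (n : ℕ) → (Fin n → ℕ) → ℕ
maxℕ zero f = 0
maxℕ (suc n) f = f zero ⊔ maxℕ n (λ i → f (suc i))

-- A flow in the network P_λ: flow on (s,i), on (i,j), and on (j,t).
record Flow (s a : ℕ) : Set where
  field
    srcF : Fin s → ℚ
    midF : Fin s → Fin a → ℚ
    snkF : Fin a → ℚ
open Flow public

data Node (s a : ℕ) : Set where
  src : Node s a
  snk : Node s a
  L   : Fin s → Node s a
  R   : Fin a → Node s a

-- The network P_λ of a phase, given current node sets Sk ⊆ S, Ak ⊆ A.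
module Network (s a : ℕ) (E : Fin s → Fin a → Bool) (v : Fin s → ℕ) (e : Fin a → ℕ)
               (Sk : Fin s → Bool) (Ak : Fin a → Bool) where

  capT : ℚ → Fin a → ℚ
  capT lam j = lam * ℕ→ℚ (e j)

  -- f is an s–t flow in P_lam (edges absent from P_lam carry zero flow)
  record IsFlow (lam : ℚ) (f : Flow s a) : Set where
    field
      src-nonneg : ∀ i → 0ℚ ≤ srcF f i
      mid-nonneg : ∀ i j → 0ℚ ≤ midF f i j
      snk-nonneg : ∀ j → 0ℚ ≤ snkF f j
      src-cap    : ∀ i → srcF f i ≤ ℕ→ℚ (v i)
      snk-cap    : ∀ j → snkF f j ≤ capT lam j
      src-supp   : ∀ i → Sk i ≡ false → srcF f i ≡ 0ℚ
      snk-supp   : ∀ j → Ak j ≡ false → snkF f j ≡ 0ℚ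
      mid-supp   : ∀ i j → (Sk i ∧ Ak j ∧ E i j) ≡ false → midF f i j ≡ 0ℚ
      cons-L     : ∀ i → Sk i ≡ true → srcF f i ≡ sumℚ a (λ j → midF f i j)
      cons-R     : ∀ j → Ak j ≡ true → sumℚ s (λ i → midF f i j) ≡ snkF f j

  value : Flow s a → ℚ
  value f = sumℚ s (srcF f)

  Saturating : ℚ → Flow s a → Set
  Saturating lam f = ∀ j → Ak j ≡ true → snkF f j ≡ capT lam j

  Feasible : ℚ → Set
  Feasible lam = Σ (Flow s a) (λ f → IsFlow lam f × Saturating lam f)

  IsMaxFeasible : ℚ → Set
  IsMaxFeasible lam =
    (0ℚ ≤ lam) × (lam ≤ 1ℚ) × Feasible lam ×
    (∀ μ → 0ℚ ≤ μ → μ ≤ 1ℚ → Feasible μ → μ ≤ lam)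

  IsMaxFlow : ℚ → Flow s a → Set
  IsMaxFlow lam f = IsFlow lam f × (∀ g → IsFlow lam g → value g ≤ value f)

  data ResEdge (lam : ℚ) (f : Flow s a) : Node s a → Node s a → Set where
    sL : ∀ {i} → Sk i ≡ true → srcF f i < ℕ→ℚ (v i) → ResEdge lam f src (L i)
    Ls : ∀ {i} → Sk i ≡ true → 0ℚ < srcF f i → ResEdge lam f (L i) src
    LR : ∀ {i j} → Sk i ≡ true → Ak j ≡ true → E i j ≡ true → ResEdge lam f (L i) (R j)
    RL : ∀ {i j} → Sk i ≡ true → Ak j ≡ true → E i j ≡ true → 0ℚ < midF f i j →
         ResEdge lam f (R j) (L i)
    Rt : ∀ {j} → Ak j ≡ true → snkF f j < capT lam j → ResEdge lam f (R j) snk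
    tR : ∀ {j} → Ak j ≡ true → 0ℚ < snkF f j → ResEdge lam f snk (R j)

  ReachableFromSrc : ℚ → Flow s a → Node s a → Set
  ReachableFromSrc lam f x = Star (ResEdge lam f) src x

-- An execution of the phase procedure (phases indexed by ℕ; once S_k or A_k is
-- empty no further phase runs, i.e. S'_k = A'_k = ∅ from then on).
record Run (s a : ℕ) (E : Fin s → Fin a → Bool) (v : Fin s → ℕ) (e : Fin a → ℕ) : Set where
  field
    S S'   : ℕ → Fin s → Bool
    A A'   : ℕ → Fin a → Bool
    lamk   : ℕ → ℚ
    flowk  : ℕ → Flow s a
    S-init : ∀ i → S 0 i ≡ true
    A-init : ∀ j → A 0 j ≡ true
    S-step : ∀ k i → S (suc k) i ≡ (S k i ∧ not (S' k i))
    A-step : ∀ k j → A (suc k) j ≡ (A k j ∧ not (A' k j))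
    phase-lam  : ∀ k → ∃ (λ i → S k i ≡ true) → ∃ (λ j → A k j ≡ true) →
                 Network.IsMaxFeasible s a E v e (S k) (A k) (lamk k)
    phase-flow : ∀ k → ∃ (λ i → S k i ≡ true) → ∃ (λ j → A k j ≡ true) →
                 Network.IsMaxFlow s a E v e (S k) (A k) (lamk k) (flowk k)
    phase-S'   : ∀ k → ∃ (λ i → S k i ≡ true) → ∃ (λ j → A k j ≡ true) → ∀ i →
                 ((S' k i ≡ true) →
                   (S k i ≡ true × ¬ Network.ReachableFromSrc s a E v e (S k) (A k) (lamk k) (flowk k) (L i)))
                 × ((S k i ≡ true × ¬ Network.ReachableFromSrc s a E v e (S k) (A k) (lamk k) (flowk k) (L i))
                   → S' k i ≡ true)
    phase-A'   : ∀ k → ∃ (λ i → S k i ≡ true) → ∃ (λ j → A k j ≡ true) → ∀ j →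
                 ((A' k j ≡ true) →
                   (A k j ≡ true × ¬ Network.ReachableFromSrc s a E v e (S k) (A k) (lamk k) (flowk k) (R j)))
                 × ((A k j ≡ true × ¬ Network.ReachableFromSrc s a E v e (S k) (A k) (lamk k) (flowk k) (R j))
                   → A' k j ≡ true)
    idle : ∀ k → ((∀ i → S k i ≡ false) ⊎ (∀ j → A k j ≡ false)) →
           (∀ i → S' k i ≡ false) × (∀ j → A' k j ≡ false)

IsOutput : {s a : ℕ} {E : Fin s → Fin a → Bool} {v : Fin s → ℕ} {e : Fin a → ℕ} →
           Run s a E v e → (Fin s → Fin a → ℚ) → Set
IsOutput {s} {a} r f = ∀ i j →
  Σ ℕ (λ k → Run.S' r k i ≡ true × Run.A' r k j ≡ true × f i j ≡ midF (Run.flowk r k) i j)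
  ⊎ ((∀ k → ¬ (Run.S' r k i ≡ true × Run.A' r k j ≡ true)) × f i j ≡ 0ℚ)

riskRatio : (s a : ℕ) (E : Fin s → Fin a → Bool) (e : Fin a → ℕ) →
            (∀ j → 0 ℕ.< e j) → (Fin s → Fin a → ℚ) → Fin a → ℚ
riskRatio s a E e epos f j =
  (ℕ→ℚ (e j) - sumℚ s (λ i → if E i j then f i j else 0ℚ))
    * _/_ (+ 1) (e j) {{ℕ.>-nonZero (epos j)}}

module Submission where

-- Fix an account j.  If j is never removed by the procedure, no output flow
-- enters it and its risk ratio is 1 = 1/1.  Otherwise j is removed in exactly
-- one phase k, and the output flow into j is the column of j in the phase-k
-- maximum flow f⁽ᵏ⁾.  Two facts about that phase determine the ratio:
--   * a maximum flow of a feasible network saturates every edge (j,t), so the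
--     column of j carries λ_k·e_j and r_j = 1 - λ_k;
--   * S'_k ∪ A'_k is the part of the network cut off from s in the residual
--     graph, so the edges (s,i), i ∈ S'_k, are saturated and no flow crosses
--     between S'_k ∪ A'_k and the rest; counting the flow from S'_k to A'_k
--     twice gives λ_k·e(A'_k) = v(S'_k).
-- Since λ_k ≤ 1 we get r_j = (e(A'_k) - v(S'_k)) / e(A'_k), and e(A'_k) is a
-- sum of at most |A| exposures, each ≤ M.

open import Defs
open import Algebra.Bundles using (CommutativeRing)
open import Data.Bool using (Bool; true; false; if_then_else_; _∧_; not)
open import Data.Bool.Properties using (∧-zeroʳ; _≟_; not-¬; ¬-not)
open import Data.Empty using (⊥-elim)
open import Data.Fin using (Fin; zero; suc)
open import Data.Fin.Properties as FinP using (any?)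
open import Data.Integer as ℤ using (+_)
import Data.Integer.Properties as ℤP
open import Data.Nat as ℕ using (ℕ; zero; suc; _+_; _*_; _∸_; _⊔_; _≤_; _<_; NonZero)
import Data.Nat.Properties as ℕP
open import Data.Product using (Σ; _×_; _,_; proj₁; proj₂; ∃)
open import Data.Rational as ℚ using (ℚ; 0ℚ; 1ℚ; _/_; toℚᵘ)
import Data.Rational.Properties as ℚP
open import Data.Rational.Solver using (module +-*-Solver)
open import Data.Rational.Unnormalised as ℚᵘ using (mkℚᵘ; *≡*; *≤*)
import Data.Rational.Unnormalised.Properties as ℚᵘP
open import Data.Sum using (_⊎_; inj₁; inj₂)
open import Function using (_∘_)
open import Relation.Binary.Construct.Closure.ReflexiveTransitive using (ε; _◅_; _◅◅_)
open import Relation.Binary.Definitions using (tri<; tri≈; tri>)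
open import Relation.Binary.PropositionalEquality
open import Relation.Nullary using (¬_; yes; no; contradiction)
open import Relation.Nullary.Negation using (¬∃⟶∀¬)

open import Algebra.Properties.Semiring.Sum (CommutativeRing.semiring ℚP.+-*-commutativeRing)
  using (sum; sum-cong-≗; sum-replicate-zero; ∑-comm; *-distribˡ-sum)
import Algebra.Properties.Semiring.Sum ℕP.+-*-semiring as ℕΣ

-- Arithmetic of the embedding ℕ→ℚ is checked in the unnormalised rationals,
-- where the fraction p/q of naturals is represented without reduction.
fraction-unnormalised : ∀ p q .{{_ : NonZero q}} →
                        toℚᵘ ((+ p) / q) ℚᵘ.≃ mkℚᵘ (+ p) (ℕ.pred q)
fraction-unnormalised p (suc q) = ℚP.toℚᵘ-fromℚᵘ (mkℚᵘ (+ p) q)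

ℕ→ℚ-+ : ∀ m n → ℕ→ℚ (m + n) ≡ ℕ→ℚ m ℚ.+ ℕ→ℚ n
ℕ→ℚ-+ m n = ℚP.toℚᵘ-injective (let open ℚᵘP.≃-Reasoning in begin
  toℚᵘ (ℕ→ℚ (m + n))             ≈⟨ fraction-unnormalised (m + n) 1 ⟩
  mkℚᵘ (+ (m + n)) 0              ≈⟨ *≡* numerators ⟩
  mkℚᵘ (+ m) 0 ℚᵘ.+ mkℚᵘ (+ n) 0  ≈⟨ ℚᵘP.+-cong (fraction-unnormalised m 1) (fraction-unnormalised n 1) ⟨
  toℚᵘ (ℕ→ℚ m) ℚᵘ.+ toℚᵘ (ℕ→ℚ n)  ≈⟨ ℚP.toℚᵘ-homo-+ (ℕ→ℚ m) (ℕ→ℚ n) ⟨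
  toℚᵘ (ℕ→ℚ m ℚ.+ ℕ→ℚ n)          ∎)
  where
  numerators : + (m + n) ℤ.* + 1 ≡ (+ m ℤ.* + 1 ℤ.+ + n ℤ.* + 1) ℤ.* + 1
  numerators = let open ≡-Reasoning in begin
    + (m + n) ℤ.* + 1                     ≡⟨ ℤP.*-identityʳ _ ⟩
    + (m + n)                             ≡⟨ ℤP.pos-+ m n ⟩
    + m ℤ.+ + n                           ≡⟨ cong₂ ℤ._+_ (ℤP.*-identityʳ (+ m)) (ℤP.*-identityʳ (+ n)) ⟨
    + m ℤ.* + 1 ℤ.+ + n ℤ.* + 1           ≡⟨ ℤP.*-identityʳ _ ⟨
    (+ m ℤ.* + 1 ℤ.+ + n ℤ.* + 1) ℤ.* + 1 ∎

ℕ→ℚ-∸ : ∀ {m n} → n ≤ m → ℕ→ℚ (m ∸ n) ≡ ℕ→ℚ m ℚ.- ℕ→ℚ n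
ℕ→ℚ-∸ {m} {n} n≤m = begin
  ℕ→ℚ (m ∸ n)                               ≡⟨ add-sub (ℕ→ℚ (m ∸ n)) (ℕ→ℚ n) ⟨
  (ℕ→ℚ (m ∸ n) ℚ.+ ℕ→ℚ n) ℚ.- ℕ→ℚ n        ≡⟨ cong (ℚ._- ℕ→ℚ n) (ℕ→ℚ-+ (m ∸ n) n) ⟨
  ℕ→ℚ (m ∸ n + n) ℚ.- ℕ→ℚ n                ≡⟨ cong (λ k → ℕ→ℚ k ℚ.- ℕ→ℚ n) (ℕP.m∸n+n≡m n≤m) ⟩
  ℕ→ℚ m ℚ.- ℕ→ℚ n                          ∎
  where
  open ≡-Reasoning
  add-sub : ∀ x y → (x ℚ.+ y) ℚ.- y ≡ x
  add-sub = solve 2 (λ x y → (x :+ y) :- y := x) refl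
    where open +-*-Solver

ℕ→ℚ-cancel-≤ : ∀ {m n} → ℕ→ℚ m ℚ.≤ ℕ→ℚ n → m ≤ n
ℕ→ℚ-cancel-≤ {m} {n} m≤n
  with ℚᵘP.≤-respʳ-≃ (fraction-unnormalised n 1)
         (ℚᵘP.≤-respˡ-≃ (fraction-unnormalised m 1) (ℚP.toℚᵘ-mono-≤ m≤n))
... | *≤* cross = ℤP.drop‿+≤+ (subst₂ ℤ._≤_ (ℤP.*-identityʳ (+ m)) (ℤP.*-identityʳ (+ n)) cross)

fraction-as-product : ∀ p q .{{_ : NonZero q}} → (+ p) / q ≡ ℕ→ℚ p ℚ.* ((+ 1) / q)
fraction-as-product p q@(suc q-1) = ℚP.toℚᵘ-injective (let open ℚᵘP.≃-Reasoning in begin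
  toℚᵘ ((+ p) / q)                       ≈⟨ fraction-unnormalised p q ⟩
  mkℚᵘ (+ p) q-1                         ≈⟨ *≡* cross ⟩
  mkℚᵘ (+ p) 0 ℚᵘ.* mkℚᵘ (+ 1) q-1        ≈⟨ ℚᵘP.*-cong (fraction-unnormalised p 1) (fraction-unnormalised 1 q) ⟨
  toℚᵘ (ℕ→ℚ p) ℚᵘ.* toℚᵘ ((+ 1) / q)     ≈⟨ ℚP.toℚᵘ-homo-* (ℕ→ℚ p) ((+ 1) / q) ⟨
  toℚᵘ (ℕ→ℚ p ℚ.* ((+ 1) / q))           ∎)
  where
  cross : + p ℤ.* + (1 ℕ.* q) ≡ (+ p ℤ.* + 1) ℤ.* + q
  cross = cong₂ ℤ._*_ (sym (ℤP.*-identityʳ (+ p))) (cong +_ (ℕP.*-identityˡ q))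

ℕ→ℚ-*-inverse : ∀ q .{{_ : NonZero q}} → ℕ→ℚ q ℚ.* ((+ 1) / q) ≡ 1ℚ
ℕ→ℚ-*-inverse q@(suc _) = begin
  ℕ→ℚ q ℚ.* ((+ 1) / q)   ≡⟨ fraction-as-product q q ⟨
  (+ q) / q               ≡⟨ ℚP.toℚᵘ-injective (ℚᵘP.≃-trans (fraction-unnormalised q q) (*≡* (ℤP.*-comm (+ q) (+ 1)))) ⟩
  1ℚ                      ∎
  where open ≡-Reasoning

remaining-fraction : ∀ q .{{_ : NonZero q}} lam →
                     (ℕ→ℚ q ℚ.- lam ℚ.* ℕ→ℚ q) ℚ.* ((+ 1) / q) ≡ 1ℚ ℚ.- lam
remaining-fraction q lam = begin
  (ℕ→ℚ q ℚ.- lam ℚ.* ℕ→ℚ q) ℚ.* ((+ 1) / q)   ≡⟨ factor (ℕ→ℚ q) lam ((+ 1) / q) ⟩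
  (1ℚ ℚ.- lam) ℚ.* (ℕ→ℚ q ℚ.* ((+ 1) / q))    ≡⟨ cong ((1ℚ ℚ.- lam) ℚ.*_) (ℕ→ℚ-*-inverse q) ⟩
  (1ℚ ℚ.- lam) ℚ.* 1ℚ                         ≡⟨ ℚP.*-identityʳ (1ℚ ℚ.- lam) ⟩
  1ℚ ℚ.- lam                                  ∎
  where
  open ≡-Reasoning
  factor : ∀ x l u → (x ℚ.- l ℚ.* x) ℚ.* u ≡ (1ℚ ℚ.- l) ℚ.* (x ℚ.* u)
  factor = solve 3 (λ x l u → (x :- l :* x) :* u := (con 1ℚ :- l) :* (x :* u)) refl
    where open +-*-Solver

complement-as-fraction : ∀ {lam} Q V .{{_ : NonZero Q}} → lam ℚ.≤ 1ℚ →
                         lam ℚ.* ℕ→ℚ Q ≡ ℕ→ℚ V → 1ℚ ℚ.- lam ≡ (+ (Q ∸ V)) / Q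
complement-as-fraction {lam} Q V lam≤1 balance = begin
  1ℚ ℚ.- lam                                   ≡⟨ remaining-fraction Q lam ⟨
  (ℕ→ℚ Q ℚ.- lam ℚ.* ℕ→ℚ Q) ℚ.* ((+ 1) / Q)    ≡⟨ cong (λ x → (ℕ→ℚ Q ℚ.- x) ℚ.* ((+ 1) / Q)) balance ⟩
  (ℕ→ℚ Q ℚ.- ℕ→ℚ V) ℚ.* ((+ 1) / Q)            ≡⟨ cong (ℚ._* ((+ 1) / Q)) (ℕ→ℚ-∸ V≤Q) ⟨
  ℕ→ℚ (Q ∸ V) ℚ.* ((+ 1) / Q)                  ≡⟨ fraction-as-product (Q ∸ V) Q ⟨
  (+ (Q ∸ V)) / Q                              ∎
  where
  open ≡-Reasoning
  V≤Q : V ≤ Q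
  V≤Q = ℕ→ℚ-cancel-≤ (subst (ℚ._≤ ℕ→ℚ Q) balance (ℚP.≤-trans
          (ℚP.*-monoʳ-≤-nonNeg (ℕ→ℚ Q) {{ℚP.normalize-nonNeg Q 1}} lam≤1)
          (ℚP.≤-reflexive (ℚP.*-identityˡ (ℕ→ℚ Q)))))

-- The sum sumℚ of the definitions is the library's finite sum, whose
-- congruence, Fubini and distributivity laws are used throughout.
sumℚ≡sum : ∀ n (f : Fin n → ℚ) → sumℚ n f ≡ sum f
sumℚ≡sum zero    f = refl
sumℚ≡sum (suc n) f = cong (f zero ℚ.+_) (sumℚ≡sum n (λ i → f (suc i)))

sum-zero : ∀ {n} {f : Fin n → ℚ} → (∀ i → f i ≡ 0ℚ) → sum f ≡ 0ℚ
sum-zero {n} f≡0 = trans (sum-cong-≗ f≡0) (sum-replicate-zero n)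

sum-mono-≤ : ∀ {n} {f g : Fin n → ℚ} → (∀ i → f i ℚ.≤ g i) → sum f ℚ.≤ sum g
sum-mono-≤ {zero}  f≤g = ℚP.≤-refl
sum-mono-≤ {suc n} f≤g = ℚP.+-mono-≤ (f≤g zero) (sum-mono-≤ (λ i → f≤g (suc i)))

sum-mono-< : ∀ {n} {f g : Fin n → ℚ} → (∀ i → f i ℚ.≤ g i) → ∀ k → f k ℚ.< g k → sum f ℚ.< sum g
sum-mono-< {suc n} f≤g zero    fk<gk = ℚP.+-mono-<-≤ fk<gk (sum-mono-≤ (λ i → f≤g (suc i)))
sum-mono-< {suc n} f≤g (suc k) fk<gk = ℚP.+-mono-≤-< (f≤g zero) (sum-mono-< (λ i → f≤g (suc i)) k fk<gk)

sum-≤-equal : ∀ {n} {f g : Fin n → ℚ} → (∀ i → f i ℚ.≤ g i) → sum g ℚ.≤ sum f → ∀ k → f k ≡ g k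
sum-≤-equal f≤g Σg≤Σf k = ℚP.≤-antisym (f≤g k)
  (ℚP.≮⇒≥ (λ fk<gk → ℚP.<-irrefl refl (ℚP.<-≤-trans (sum-mono-< f≤g k fk<gk) Σg≤Σf)))

mask : Bool → ℚ → ℚ
mask b x = if b then x else 0ℚ

mask-cong : ∀ b {x y} → (b ≡ true → x ≡ y) → mask b x ≡ mask b y
mask-cong true  x≡y = x≡y refl
mask-cong false x≡y = refl

mask-redundant : ∀ b {x} → (b ≡ false → x ≡ 0ℚ) → mask b x ≡ x
mask-redundant true  x≡0 = refl
mask-redundant false x≡0 = sym (x≡0 refl)

mask-of-zero : ∀ b {x} → x ≡ 0ℚ → mask b x ≡ 0ℚ
mask-of-zero true  x≡0 = x≡0
mask-of-zero false x≡0 = refl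

mask-sum : ∀ {n} b (f : Fin n → ℚ) → mask b (sum f) ≡ sum (λ i → mask b (f i))
mask-sum true  f = refl
mask-sum {n} false f = sym (sum-zero {n} (λ _ → refl))

mask-comm : ∀ b c x → mask b (mask c x) ≡ mask c (mask b x)
mask-comm true  c     x = refl
mask-comm false true  x = refl
mask-comm false false x = refl

mask-scale : ∀ b c x → mask b (c ℚ.* x) ≡ c ℚ.* mask b x
mask-scale true  c x = refl
mask-scale false c x = sym (ℚP.*-zeroʳ c)

masked-sum-comm : ∀ {m n} (B : Fin m → Bool) (C : Fin n → Bool) (h : Fin m → Fin n → ℚ) →
  sum (λ i → mask (B i) (sum (λ j → mask (C j) (h i j)))) ≡
  sum (λ j → mask (C j) (sum (λ i → mask (B i) (h i j))))
masked-sum-comm B C h = begin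
  sum (λ i → mask (B i) (sum (λ j → mask (C j) (h i j))))  ≡⟨ sum-cong-≗ (λ i → mask-sum (B i) (λ j → mask (C j) (h i j))) ⟩
  sum (λ i → sum (λ j → mask (B i) (mask (C j) (h i j))))  ≡⟨ ∑-comm (λ i j → mask (B i) (mask (C j) (h i j))) ⟩
  sum (λ j → sum (λ i → mask (B i) (mask (C j) (h i j))))  ≡⟨ sum-cong-≗ (λ j → sum-cong-≗ (λ i → mask-comm (B i) (C j) _)) ⟩
  sum (λ j → sum (λ i → mask (C j) (mask (B i) (h i j))))  ≡⟨ sum-cong-≗ (λ j → mask-sum (C j) (λ i → mask (B i) (h i j))) ⟨
  sum (λ j → mask (C j) (sum (λ i → mask (B i) (h i j))))  ∎
  where open ≡-Reasoning

total : ∀ {n} → (Fin n → Bool) → (Fin n → ℕ) → ℕ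
total B w = ℕΣ.sum (λ i → if B i then w i else 0)

total-ℕ→ℚ : ∀ {n} (B : Fin n → Bool) (w : Fin n → ℕ) →
            ℕ→ℚ (total B w) ≡ sum (λ i → mask (B i) (ℕ→ℚ (w i)))
total-ℕ→ℚ {zero}  B w = refl
total-ℕ→ℚ {suc n} B w = trans (ℕ→ℚ-+ (if B zero then w zero else 0) (total (B ∘ suc) (w ∘ suc)))
                              (cong₂ ℚ._+_ (head-term (B zero)) (total-ℕ→ℚ (B ∘ suc) (w ∘ suc)))
  where
  head-term : ∀ b → ℕ→ℚ (if b then w zero else 0) ≡ mask b (ℕ→ℚ (w zero))
  head-term true  = refl
  head-term false = refl

total-≤ : ∀ {n} (B : Fin n → Bool) {w : Fin n → ℕ} {bound} → (∀ i → w i ≤ bound) → total B w ≤ n * bound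
total-≤ {zero}  B w≤ = ℕ.z≤n
total-≤ {suc n} B {w} {bound} w≤ = ℕP.+-mono-≤ (head-term (B zero)) (total-≤ (B ∘ suc) (w≤ ∘ suc))
  where
  head-term : ∀ b → (if b then w zero else 0) ≤ bound
  head-term true  = w≤ zero
  head-term false = ℕ.z≤n

member-≤-total : ∀ {n} (B : Fin n → Bool) (w : Fin n → ℕ) k → B k ≡ true → w k ≤ total B w
member-≤-total B w zero    Bk = subst (λ b → w zero ≤ (if b then w zero else 0) + total (B ∘ suc) (w ∘ suc))
                                       (sym Bk) (ℕP.m≤m+n _ _)
member-≤-total B w (suc k) Bk = ℕP.≤-trans (member-≤-total (B ∘ suc) (w ∘ suc) k Bk) (ℕP.m≤n+m _ _)

maxℕ-≥ : ∀ n (f : Fin n → ℕ) k → f k ≤ maxℕ n f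
maxℕ-≥ (suc n) f zero    = ℕP.m≤m⊔n _ _
maxℕ-≥ (suc n) f (suc k) = ℕP.≤-trans (maxℕ-≥ n (f ∘ suc) k) (ℕP.m≤n⊔m (f zero) _)

some-or-all : ∀ {n} {P Q : Fin n → Set} → (∀ i → P i ⊎ Q i) → ∃ P ⊎ (∀ i → Q i)
some-or-all {zero}  choice = inj₂ λ ()
some-or-all {suc n} choice with choice zero | some-or-all (λ i → choice (suc i))
... | inj₁ p | _              = inj₁ (zero , p)
... | inj₂ _ | inj₁ (i , p)   = inj₁ (suc i , p)
... | inj₂ q | inj₂ qs        = inj₂ λ { zero → q ; (suc i) → qs i }

module FlowFacts (s a : ℕ) (E : Fin s → Fin a → Bool) (v : Fin s → ℕ) (e : Fin a → ℕ)
                 (Sk : Fin s → Bool) (Ak : Fin a → Bool) where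
  open Network s a E v e Sk Ak

  edge? : ∀ i j → (Sk i ≡ true × Ak j ≡ true × E i j ≡ true) ⊎ ((Sk i ∧ Ak j ∧ E i j) ≡ false)
  edge? i j with Sk i | Ak j | E i j
  ... | true  | true  | true  = inj₁ (refl , refl , refl)
  ... | true  | true  | false = inj₂ refl
  ... | true  | false | _     = inj₂ refl
  ... | false | _     | _     = inj₂ refl

  left-absent : ∀ {i} j → Sk i ≡ false → (Sk i ∧ Ak j ∧ E i j) ≡ false
  left-absent j Ski≡false rewrite Ski≡false = refl

  right-absent : ∀ i {j} → Ak j ≡ false → (Sk i ∧ Ak j ∧ E i j) ≡ false
  right-absent i Akj≡false rewrite Akj≡false = ∧-zeroʳ (Sk i)

  non-edge : ∀ {i j} → E i j ≡ false → (Sk i ∧ Ak j ∧ E i j) ≡ false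
  non-edge {i} {j} Eij≡false rewrite Eij≡false | ∧-zeroʳ (Ak j) = ∧-zeroʳ (Sk i)

  module Conservation {lam} {g : Flow s a} (g-flow : IsFlow lam g) where
    open IsFlow g-flow

    -- Conservation at every left node; absent nodes carry no flow at all.
    outflow : ∀ i → srcF g i ≡ sum (midF g i)
    outflow i with Sk i in Ski
    ... | true  = trans (cons-L i Ski) (sumℚ≡sum a (midF g i))
    ... | false = trans (src-supp i Ski) (sym (sum-zero (λ j → mid-supp i j (left-absent j Ski))))

    inflow : ∀ j → sum (λ i → midF g i j) ≡ snkF g j
    inflow j with Ak j in Akj
    ... | true  = trans (sym (sumℚ≡sum s (λ i → midF g i j))) (cons-R j Akj)
    ... | false = trans (sum-zero (λ i → mid-supp i j (right-absent i Akj))) (sym (snk-supp j Akj))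

    value≡sink-total : value g ≡ sum (snkF g)
    value≡sink-total = begin
      value g                              ≡⟨ sumℚ≡sum s (srcF g) ⟩
      sum (srcF g)                         ≡⟨ sum-cong-≗ outflow ⟩
      sum (λ i → sum (midF g i))           ≡⟨ ∑-comm (midF g) ⟩
      sum (λ j → sum (λ i → midF g i j))   ≡⟨ sum-cong-≗ inflow ⟩
      sum (snkF g)                         ∎
      where open ≡-Reasoning

  open Conservation public

  -- In a feasible network every maximum flow saturates all edges (j,t): a
  -- saturating flow g bounds f edgewise from above, and has no larger value.
  maxFlow-saturates : ∀ {lam f} → IsMaxFeasible lam → IsMaxFlow lam f → Saturating lam f
  maxFlow-saturates {lam} {f} (_ , _ , (g , g-flow , g-sat) , _) (f-flow , f-max) j Akj =
    trans (sum-≤-equal f≤g Σg≤Σf j) (g-sat j Akj)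
    where
    f≤g : ∀ j → snkF f j ℚ.≤ snkF g j
    f≤g j with Ak j in Akj
    ... | true  = ℚP.≤-trans (IsFlow.snk-cap f-flow j) (ℚP.≤-reflexive (sym (g-sat j Akj)))
    ... | false = ℚP.≤-reflexive (trans (IsFlow.snk-supp f-flow j Akj) (sym (IsFlow.snk-supp g-flow j Akj)))
    Σg≤Σf : sum (snkF g) ℚ.≤ sum (snkF f)
    Σg≤Σf = subst₂ ℚ._≤_ (value≡sink-total g-flow) (value≡sink-total f-flow) (f-max g g-flow)

  -- B marks exactly the present nodes `node x` that are unreachable from s
  -- in the residual network of f (the sets S'_k, A'_k of the procedure).
  UnreachablePart : ∀ {n} → (Fin n → Bool) → (Fin n → Node s a) → ℚ → Flow s a → (Fin n → Bool) → Set
  UnreachablePart present node lam f B = ∀ x →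
    (B x ≡ true → present x ≡ true × ¬ ReachableFromSrc lam f (node x)) ×
    (present x ≡ true × ¬ ReachableFromSrc lam f (node x) → B x ≡ true)

  module Cut {lam} {f : Flow s a} (f-flow : IsFlow lam f) (f-sat : Saturating lam f)
             {S' : Fin s → Bool} {A' : Fin a → Bool}
             (S'-cut : UnreachablePart Sk L lam f S') (A'-cut : UnreachablePart Ak R lam f A') where
    open IsFlow f-flow

    reachable-outside : ∀ {n} {present} {node : Fin n → Node s a} {B} → UnreachablePart present node lam f B →
                        ∀ x → B x ≡ false → present x ≡ true → ¬ ¬ ReachableFromSrc lam f (node x)
    reachable-outside cut x Bx≡false present-x unreachable
      with trans (sym Bx≡false) (proj₂ (cut x) (present-x , unreachable))
    ... | ()

    -- Every source edge into S' is saturated, else the residual edge (s,i) would reach i.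
    source-saturated : ∀ i → S' i ≡ true → srcF f i ≡ ℕ→ℚ (v i)
    source-saturated i S'i with proj₁ (S'-cut i) S'i
    ... | Ski , unreachable = ℚP.≤-antisym (src-cap i) (ℚP.≮⇒≥ (λ lt → unreachable (sL Ski lt ◅ ε)))

    -- No flow enters A' from outside S': the infinite edge (i,j) would make j reachable.
    no-flow-into-cut : ∀ i j → A' j ≡ true → S' i ≡ false → midF f i j ≡ 0ℚ
    no-flow-into-cut i j A'j S'i≡false with edge? i j
    ... | inj₂ absent = mid-supp i j absent
    ... | inj₁ (Ski , Akj , Eij) = ⊥-elim (reachable-outside S'-cut i S'i≡false Ski
            (λ reach-i → proj₂ (proj₁ (A'-cut j) A'j) (reach-i ◅◅ (LR Ski Akj Eij ◅ ε))))

    -- No flow leaves S' outside A': a positive f_ij gives the residual edge (j,i).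
    no-flow-out-of-cut : ∀ i j → S' i ≡ true → A' j ≡ false → midF f i j ≡ 0ℚ
    no-flow-out-of-cut i j S'i A'j≡false with edge? i j
    ... | inj₂ absent = mid-supp i j absent
    ... | inj₁ (Ski , Akj , Eij) = ℚP.≤-antisym
            (ℚP.≮⇒≥ (λ positive → reachable-outside A'-cut j A'j≡false Akj
              (λ reach-j → proj₂ (proj₁ (S'-cut i) S'i) (reach-j ◅◅ (RL Ski Akj Eij positive ◅ ε)))))
            (mid-nonneg i j)

    column-load : ∀ j → A' j ≡ true → sum (λ i → midF f i j) ≡ lam ℚ.* ℕ→ℚ (e j)
    column-load j A'j = trans (inflow f-flow j) (f-sat j (proj₁ (proj₁ (A'-cut j) A'j)))

    source-side : ∀ i → mask (S' i) (ℕ→ℚ (v i)) ≡ mask (S' i) (sum (λ j → mask (A' j) (midF f i j)))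
    source-side i = mask-cong (S' i) λ S'i → begin
      ℕ→ℚ (v i)                               ≡⟨ source-saturated i S'i ⟨
      srcF f i                                ≡⟨ outflow f-flow i ⟩
      sum (midF f i)                          ≡⟨ sum-cong-≗ (λ j → mask-redundant (A' j) (no-flow-out-of-cut i j S'i)) ⟨
      sum (λ j → mask (A' j) (midF f i j))    ∎
      where open ≡-Reasoning

    sink-side : ∀ j → mask (A' j) (sum (λ i → mask (S' i) (midF f i j))) ≡ mask (A' j) (lam ℚ.* ℕ→ℚ (e j))
    sink-side j = mask-cong (A' j) λ A'j → begin
      sum (λ i → mask (S' i) (midF f i j))    ≡⟨ sum-cong-≗ (λ i → mask-redundant (S' i) (no-flow-into-cut i j A'j)) ⟩
      sum (λ i → midF f i j)                  ≡⟨ column-load j A'j ⟩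
      lam ℚ.* ℕ→ℚ (e j)                       ∎
      where open ≡-Reasoning

    -- Counting the flow from S' to A' twice: λ · e(A') = v(S').
    cut-balance : lam ℚ.* ℕ→ℚ (total A' e) ≡ ℕ→ℚ (total S' v)
    cut-balance = begin
      lam ℚ.* ℕ→ℚ (total A' e)                                    ≡⟨ cong (lam ℚ.*_) (total-ℕ→ℚ A' e) ⟩
      lam ℚ.* sum (λ j → mask (A' j) (ℕ→ℚ (e j)))                 ≡⟨ *-distribˡ-sum lam (λ j → mask (A' j) (ℕ→ℚ (e j))) ⟩
      sum (λ j → lam ℚ.* mask (A' j) (ℕ→ℚ (e j)))                 ≡⟨ sum-cong-≗ (λ j → mask-scale (A' j) lam (ℕ→ℚ (e j))) ⟨
      sum (λ j → mask (A' j) (lam ℚ.* ℕ→ℚ (e j)))                 ≡⟨ sum-cong-≗ sink-side ⟨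
      sum (λ j → mask (A' j) (sum (λ i → mask (S' i) (midF f i j)))) ≡⟨ masked-sum-comm S' A' (midF f) ⟨
      sum (λ i → mask (S' i) (sum (λ j → mask (A' j) (midF f i j)))) ≡⟨ sum-cong-≗ source-side ⟨
      sum (λ i → mask (S' i) (ℕ→ℚ (v i)))                         ≡⟨ total-ℕ→ℚ S' v ⟨
      ℕ→ℚ (total S' v)                                            ∎
      where open ≡-Reasoning

module RunFacts {s a E v e} (r : Run s a E v e) where
  open Run r

  Active : ℕ → Set
  Active k = ∃ (λ i → S k i ≡ true) × ∃ (λ j → A k j ≡ true)

  removal-is-active : ∀ {k j} → A' k j ≡ true → Active k
  removal-is-active {k} {j} A'kj with any? (λ i → S k i ≟ true) | any? (λ j → A k j ≟ true)
  ... | yes someS | yes someA = someS , someA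
  ... | no noS    | _         = contradiction A'kj (not-¬ (proj₂ (idle k (inj₁ λ i → ¬-not (¬∃⟶∀¬ noS i))) j))
  ... | yes _     | no noA    = contradiction A'kj (not-¬ (proj₂ (idle k (inj₂ λ j → ¬-not (¬∃⟶∀¬ noA j))) j))

  removed⇒present : ∀ {k j} → A' k j ≡ true → A k j ≡ true
  removed⇒present {k} {j} A'kj with removal-is-active A'kj
  ... | someS , someA = proj₁ (proj₁ (phase-A' k someS someA j) A'kj)

  absent-after-removal : ∀ {k j} → A' k j ≡ true → ∀ m → k < m → A m j ≡ false
  absent-after-removal {k} {j} A'kj (suc m) (ℕ.s≤s k≤m) with ℕP.m≤n⇒m<n∨m≡n k≤m
  ... | inj₁ k<m  = trans (A-step m j) (cong (λ b → b ∧ not (A' m j)) (absent-after-removal A'kj m k<m))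
  ... | inj₂ refl = trans (A-step k j) (cong₂ (λ b c → b ∧ not c) (removed⇒present A'kj) A'kj)

  removed-once : ∀ {k k' j} → A' k j ≡ true → A' k' j ≡ true → k ≡ k'
  removed-once {k} {k'} A'kj A'k'j with ℕP.<-cmp k k'
  ... | tri≈ _ k≡k' _ = k≡k'
  ... | tri< k<k' _ _ = contradiction (absent-after-removal A'kj k' k<k') (not-¬ (removed⇒present A'k'j))
  ... | tri> _ _ k'<k = contradiction (absent-after-removal A'k'j k k'<k) (not-¬ (removed⇒present A'kj))

  module Phase {k} (active : Active k) where
    open Network s a E v e (S k) (A k) using (IsMaxFeasible; IsMaxFlow; module IsFlow)
    open FlowFacts s a E v e (S k) (A k) public

    lam-maximal : IsMaxFeasible (lamk k)
    lam-maximal = phase-lam k (proj₁ active) (proj₂ active)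

    lamk≤1 : lamk k ℚ.≤ 1ℚ
    lamk≤1 = proj₁ (proj₂ lam-maximal)

    max-flow : IsMaxFlow (lamk k) (flowk k)
    max-flow = phase-flow k (proj₁ active) (proj₂ active)

    open IsFlow (proj₁ max-flow) using (mid-supp) public
    open Cut (proj₁ max-flow) (maxFlow-saturates lam-maximal max-flow)
             (phase-S' k (proj₁ active) (proj₂ active)) (phase-A' k (proj₁ active) (proj₂ active)) public

module OutputFacts {s a E v e} (r : Run s a E v e) {f : Fin s → Fin a → ℚ} (f-output : IsOutput r f) where
  open Run r
  open RunFacts r

  inflowOf : Fin a → ℚ
  inflowOf j = sumℚ s (λ i → mask (E i j) (f i j))

  removed-or-idle : ∀ j → (Σ ℕ λ k → A' k j ≡ true) ⊎ (∀ i → f i j ≡ 0ℚ)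
  removed-or-idle j with some-or-all (λ i → f-output i j)
  ... | inj₁ (_ , k , _ , A'kj , _) = inj₁ (k , A'kj)
  ... | inj₂ never                  = inj₂ (λ i → proj₂ (never i))

  idle-inflow : ∀ {j} → (∀ i → f i j ≡ 0ℚ) → inflowOf j ≡ 0ℚ
  idle-inflow {j} fj≡0 = trans (sumℚ≡sum s _) (sum-zero (λ i → mask-of-zero (E i j) (fj≡0 i)))

  -- In the phase removing j, the output column of j is the column of the
  -- phase's maximum flow, which carries λ_k e_j.
  removed-inflow : ∀ {k j} → A' k j ≡ true → inflowOf j ≡ lamk k ℚ.* ℕ→ℚ (e j)
  removed-inflow {k} {j} A'kj = begin
    inflowOf j                                ≡⟨ sumℚ≡sum s _ ⟩
    sum (λ i → mask (E i j) (f i j))          ≡⟨ sum-cong-≗ agree ⟩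
    sum (λ i → midF (flowk k) i j)            ≡⟨ column-load j A'kj ⟩
    lamk k ℚ.* ℕ→ℚ (e j)                      ∎
    where
    open ≡-Reasoning
    open Phase (removal-is-active A'kj)
    agree : ∀ i → mask (E i j) (f i j) ≡ midF (flowk k) i j
    agree i with f-output i j
    ... | inj₁ (k' , _ , A'k'j , fij≡) with removed-once A'kj A'k'j
    ...   | refl = trans (mask-cong (E i j) (λ _ → fij≡)) (mask-redundant (E i j) (λ Eij≡false → mid-supp i j (non-edge Eij≡false)))
    agree i | inj₂ (never , fij≡0) = trans (mask-of-zero (E i j) fij≡0)
      (sym (no-flow-into-cut i j A'kj (¬-not (λ S'ki → never k (S'ki , A'kj)))))

  record ColumnLoad (j : Fin a) (bound : ℕ) : Set where
    field
      lam     : ℚ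
      lam≤1   : lam ℚ.≤ 1ℚ
      Q V     : ℕ
      Q≢0     : NonZero Q
      Q≤bound : Q ≤ bound
      inflow≡ : inflowOf j ≡ lam ℚ.* ℕ→ℚ (e j)
      balance : lam ℚ.* ℕ→ℚ Q ≡ ℕ→ℚ V

  risk-ratio-as-fraction : (epos : ∀ j → 0 < e j) → ∀ {j bound} (load : ColumnLoad j bound) →
    let open ColumnLoad load in
    riskRatio s a E e epos f j ≡ ((+ (Q ∸ V)) / Q) {{Q≢0}}
  risk-ratio-as-fraction epos {j} load = begin
    riskRatio s a E e epos f j                              ≡⟨ cong (λ x → (ℕ→ℚ (e j) ℚ.- x) ℚ.* 1/eⱼ) inflow≡ ⟩
    (ℕ→ℚ (e j) ℚ.- lam ℚ.* ℕ→ℚ (e j)) ℚ.* 1/eⱼ             ≡⟨ remaining-fraction (e j) {{eⱼ≢0}} lam ⟩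
    1ℚ ℚ.- lam                                              ≡⟨ complement-as-fraction Q V {{Q≢0}} lam≤1 balance ⟩
    ((+ (Q ∸ V)) / Q) {{Q≢0}}                               ∎
    where
    open ≡-Reasoning
    open ColumnLoad load
    eⱼ≢0 : NonZero (e j)
    eⱼ≢0 = ℕ.>-nonZero (epos j)
    1/eⱼ : ℚ
    1/eⱼ = ((+ 1) / e j) {{eⱼ≢0}}

  M : ℕ
  M = maxℕ s v ⊔ maxℕ a e

  e≤M : ∀ j → e j ≤ M
  e≤M j = ℕP.≤-trans (maxℕ-≥ a e j) (ℕP.m≤n⊔m (maxℕ s v) (maxℕ a e))

  exposure-total≤nM : ∀ B → total B e ≤ (s + a) * M
  exposure-total≤nM B = ℕP.≤-trans (total-≤ B e≤M) (ℕP.*-monoˡ-≤ M (ℕP.m≤n+m a s))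

  -- A single exposure is at most M ≤ n·M (n ≥ 1 since there is an account).
  exposure≤nM : ∀ j → e j ≤ (s + a) * M
  exposure≤nM j = ℕP.≤-trans (e≤M j) (ℕP.m≤n*m M (s + a) {{n≢0}})
    where
    n≢0 : NonZero (s + a)
    n≢0 = ℕ.>-nonZero (ℕP.<-≤-trans (ℕP.≤-<-trans ℕ.z≤n (FinP.toℕ<n j)) (ℕP.m≤n+m a s))

  -- Every column admits a load certificate: a removed account carries λ_k e_j
  -- with λ_k·e(A'_k) = v(S'_k); an account never removed carries nothing.
  load-certificate : (∀ j → 0 < e j) → ∀ j → ColumnLoad j ((s + a) * M)
  load-certificate epos j with removed-or-idle j
  ... | inj₁ (k , A'kj) = record
    { lam = lamk k ; lam≤1 = lamk≤1 ; Q = total (A' k) e ; V = total (S' k) v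
    ; Q≢0 = ℕ.>-nonZero (ℕP.≤-trans (epos j) (member-≤-total (A' k) e j A'kj))
    ; Q≤bound = exposure-total≤nM (A' k) ; inflow≡ = removed-inflow A'kj ; balance = cut-balance }
    where open Phase (removal-is-active A'kj)
  ... | inj₂ idle = record
    { lam = 0ℚ ; lam≤1 = ℚP.nonNegative⁻¹ 1ℚ ; Q = e j ; V = 0
    ; Q≢0 = ℕ.>-nonZero (epos j) ; Q≤bound = exposure≤nM j
    ; inflow≡ = trans (idle-inflow idle) (sym (ℚP.*-zeroˡ (ℕ→ℚ (e j)))) ; balance = ℚP.*-zeroˡ (ℕ→ℚ (e j)) }

mainTheorem3 : (s a : ℕ) (E : Fin s → Fin a → Bool) (v : Fin s → ℕ) (e : Fin a → ℕ)
    (epos : ∀ j → 0 < e j) (r : Run s a E v e) (f : Fin s → Fin a → ℚ) →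
    IsOutput r f → ∀ j →
    Σ ℕ (λ p → Σ ℕ (λ q → Σ (NonZero q) (λ nz →
      p ≤ (s + a) * (maxℕ s v ⊔ maxℕ a e) ×
      q ≤ (s + a) * (maxℕ s v ⊔ maxℕ a e) ×
      riskRatio s a E e epos f j ≡ _/_ (+ p) q {{nz}})))
mainTheorem3 s a E v e epos r f f-output j =
  Q ∸ V , Q , Q≢0 , ℕP.≤-trans (ℕP.m∸n≤m Q V) Q≤bound , Q≤bound , risk-ratio-as-fraction epos load
  where
  open OutputFacts r f-output
  load : ColumnLoad j ((s + a) * M)
  load = load-certificate epos j
  open ColumnLoad load
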